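{- Let $G$ be a finite simple connected graph with $|E(G)|>\nu_2(G)$ and $\nu_2(G)\ge 5$, and let $R$ be a maximum 2-packing of $G$. If $\gamma(G)=\nu_2(G)-1$, then $G[R]$ is a forest.
   Context: A 2-packing of a graph $G$ is a set $R\subseteq E(G)$ such that no three edges of $R$ are incident with a common vertex; $\nu_2(G)$ is the maximum size of a 2-packing, and a maximum 2-packing is one of that size. $G[R]$ denotes the subgraph of $G$ formed by the edges of $R$ together with their endpoints. $\gamma(G)$ is the domination number: the minimum size of a set $D\subseteq V(G)$ such that every vertex is in $D$ or adjacent to a vertex of $D$. -}

module Defs where

open import Data.Nat using (ℕ; zero; suc; _+_; _≤_; _<_; _<ᵇ_)
open import Data.Fin using (Fin; toℕ) renaming (zero to fzero; suc to fsuc)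
open import Data.Bool using (Bool; true; false; _∧_)
open import Data.List using (List; []; _∷_; length; _++_)
open import Data.List.Relation.Unary.Unique.Propositional using (Unique)
open import Data.Product using (Σ; ∃; _×_; _,_)
open import Data.Sum using (_⊎_)
open import Relation.Binary.PropositionalEquality using (_≡_)
open import Relation.Nullary using (¬_)
open import Data.Unit using (⊤)

record Graph : Set where
  field
    n      : ℕ
    adj    : Fin n → Fin n → Bool
    sym    : ∀ u v → adj u v ≡ adj v u
    irrefl : ∀ v → adj v v ≡ false
open Graph public

sumFin : ∀ {m} → (Fin m → ℕ) → ℕ
sumFin {zero}  f = 0
sumFin {suc m} f = f fzero + sumFin (λ i → f (fsuc i))

b2n : Bool → ℕ
b2n true  = 1
b2n false = 0

count : ∀ {m} → (Fin m → Bool) → ℕ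
count p = sumFin (λ i → b2n (p i))

-- number of unordered pairs {u,v} (u ≠ v) with e u v = true, for a
-- symmetric irreflexive e: count ordered pairs with toℕ u < toℕ v
edgeCount : ∀ {m} → (Fin m → Fin m → Bool) → ℕ
edgeCount e = sumFin (λ u → count (λ v → (toℕ u <ᵇ toℕ v) ∧ e u v))

numEdges : Graph → ℕ
numEdges G = edgeCount (adj G)

record EdgeSet (G : Graph) : Set where
  field
    mem    : Fin (n G) → Fin (n G) → Bool
    memSym : ∀ u v → mem u v ≡ mem v u
    memSub : ∀ u v → mem u v ≡ true → adj G u v ≡ true
open EdgeSet public

size : ∀ {G} → EdgeSet G → ℕ
size R = edgeCount (mem R)

degIn : ∀ {G} → EdgeSet G → Fin (n G) → ℕ
degIn R v = count (mem R v)

-- 2-packing: no three edges of R share a vertex, i.e. every vertex meets ≤ 2 edges of R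
Is2Packing : ∀ {G} → EdgeSet G → Set
Is2Packing {G} R = ∀ (v : Fin (n G)) → degIn R v ≤ 2

IsMax2Packing : ∀ {G} → EdgeSet G → Set
IsMax2Packing {G} R = Is2Packing R × (∀ (R' : EdgeSet G) → Is2Packing R' → size R' ≤ size R)

data Walk (G : Graph) : Fin (n G) → Fin (n G) → Set where
  here : ∀ {u} → Walk G u u
  step : ∀ {u w v} → adj G u w ≡ true → Walk G w v → Walk G u v

Connected : Graph → Set
Connected G = ∀ (u v : Fin (n G)) → Walk G u v

VSet : Graph → Set
VSet G = Fin (n G) → Bool

card : ∀ {G} → VSet G → ℕ
card D = count D

Dominating : ∀ (G : Graph) → VSet G → Set
Dominating G D = ∀ (v : Fin (n G)) →
  (D v ≡ true) ⊎ (Σ (Fin (n G)) λ u → (D u ≡ true) × (adj G u v ≡ true))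

IsDominationNumber : Graph → ℕ → Set
IsDominationNumber G k =
  (Σ (VSet G) λ D → Dominating G D × (card {G} D ≡ k))
  × (∀ (D : VSet G) → Dominating G D → k ≤ card {G} D)

PathIn : ∀ {G} → EdgeSet G → List (Fin (n G)) → Set
PathIn R []            = ⊤
PathIn R (x ∷ [])      = ⊤
PathIn R (x ∷ y ∷ xs)  = (mem R x y ≡ true) × PathIn R (y ∷ xs)

-- a cycle in the graph (V, R): distinct vertices v₀,…,v_{k-1}, k ≥ 3,
-- with v_i v_{i+1} ∈ R and v_{k-1} v₀ ∈ R
record CycleIn {G : Graph} (R : EdgeSet G) : Set where
  field
    first    : Fin (n G)
    rest     : List (Fin (n G))
    last     : Fin (n G)
    distinct : Unique (first ∷ rest ++ (last ∷ []))
    long     : 1 ≤ length rest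
    path     : PathIn R (first ∷ rest ++ (last ∷ []))
    closing  : mem R last first ≡ true

-- G[R] is a forest: the subgraph formed by the edges of R has no cycle
-- (vertices not incident with R are isolated and cannot lie on a cycle)
IsForest : ∀ {G} → EdgeSet G → Set
IsForest R = ¬ CycleIn R

-- Suppose G[R] contains a cycle. Maximality of R rules out two augmentations: adding a G-edge
-- between two vertices of R-degree at most 1, and trading an R-edge ab for edges ax and by where
-- x and y are uncovered by R. Hence every R-edge has a clean end (one with no uncovered neighbour),
-- and the cycle carries two distinct clean vertices c₁, c₂. Let D consist of the vertices of
-- R-degree 2 other than c₁, c₂, together with one end of every component of G[R] that is a single
-- edge. Then D dominates G: an uncovered vertex has a neighbour of R-degree 2 (by the first
-- augmentation), which is neither c₁ nor c₂ since these are clean, and c₁, c₂ are dominated by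
-- their cycle neighbours. Counting R-degrees gives 2|D| + 4 ≤ 2|R|, so γ(G) ≤ ν₂(G) − 2.

module Submission where

open import Defs renaming (sym to adj-sym)
open import Data.Nat using (ℕ; zero; suc; _+_; _*_; _∸_; _≤_; _<_; _≤?_; _<?_; _<ᵇ_; _≡ᵇ_; z≤n; s≤s)
open import Data.Nat.Properties
  using ( +-*-semiring; +-identityʳ; *-identityʳ; *-suc; +-mono-≤; m≤m+n; m≤n+m
        ; ≤-refl; ≤-reflexive; ≤-trans; ≤-antisym; ≤-pred; ≤∧≢⇒<; <-cmp; 1+n≰n; n≮n
        ; *-cancelˡ-≡; *-cancelˡ-≤; ∸-monoˡ-≤; module ≤-Reasoning)
  renaming (_≟_ to _≟ℕ_)
open import Data.Nat.Tactic.RingSolver using (solve-∀)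
open import Data.Fin using (Fin; zero; suc; toℕ; _≟_; punchIn)
open import Data.Fin.Properties using (punchInᵢ≢i; toℕ-injective; any?)
open import Data.Bool using (Bool; true; false; _∧_; _∨_; not; if_then_else_)
open import Data.Bool.Properties
  using (∧-identityʳ; ∧-zeroʳ; ∧-comm; ∨-comm) renaming (_≟_ to _≟ᴮ_)
open import Data.List using (List; []; _∷_; _++_; length)
open import Data.List.Membership.Propositional using (_∈_)
open import Data.List.Membership.Propositional.Properties using (∈-++⁺ˡ; ∈-++⁺ʳ; ∈-++⁻)
open import Data.List.Relation.Unary.Any using (here; there)
open import Data.List.Relation.Unary.All as All using (All; []; _∷_)
open import Data.List.Relation.Unary.AllPairs using ([]; _∷_)
open import Data.List.Relation.Unary.Unique.Propositional using (Unique)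
open import Data.Product using (∃; _×_; _,_; proj₁; proj₂)
open import Data.Empty using (⊥; ⊥-elim)
open import Data.Sum using (_⊎_; inj₁; inj₂)
open import Function using (_∘_; const)
open import Relation.Nullary using (Dec; does; yes; no; ¬_; contradiction)
open import Relation.Nullary.Decidable using (_×-dec_; dec-true; dec-false)
open import Relation.Binary using (tri<; tri≈; tri>)
open import Relation.Binary.PropositionalEquality
  using (_≡_; _≢_; refl; sym; trans; cong; cong₂; subst; module ≡-Reasoning)
import Algebra.Properties.Semiring.Sum +-*-semiring as Σ

private variable
  m : ℕ

sumFin≡sum : (f : Fin m → ℕ) → sumFin f ≡ Σ.sum f
sumFin≡sum {zero}  f = refl
sumFin≡sum {suc m} f = cong (f zero +_) (sumFin≡sum (f ∘ suc))

sumFin-via-sum : ∀ {k} {f : Fin m → ℕ} {g : Fin k → ℕ} → Σ.sum f ≡ Σ.sum g → sumFin f ≡ sumFin g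
sumFin-via-sum {f = f} {g} eq = trans (sumFin≡sum f) (trans eq (sym (sumFin≡sum g)))

sumFin-cong : {f g : Fin m → ℕ} → (∀ i → f i ≡ g i) → sumFin f ≡ sumFin g
sumFin-cong {f = f} {g} f≗g = sumFin-via-sum {f = f} {g} (Σ.sum-cong-≗ f≗g)

sumFin-distrib-+ : (f g : Fin m → ℕ) → sumFin (λ i → f i + g i) ≡ sumFin f + sumFin g
sumFin-distrib-+ f g = begin
  sumFin (λ i → f i + g i)  ≡⟨ sumFin≡sum (λ i → f i + g i) ⟩
  Σ.sum (λ i → f i + g i)   ≡⟨ Σ.∑-distrib-+ f g ⟩
  Σ.sum f + Σ.sum g         ≡⟨ sym (cong₂ _+_ (sumFin≡sum f) (sumFin≡sum g)) ⟩
  sumFin f + sumFin g       ∎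
  where open ≡-Reasoning

sumFin-*ˡ : ∀ k (f : Fin m → ℕ) → sumFin (λ i → k * f i) ≡ k * sumFin f
sumFin-*ˡ k f = begin
  sumFin (λ i → k * f i)  ≡⟨ sumFin≡sum (λ i → k * f i) ⟩
  Σ.sum (λ i → k * f i)   ≡⟨ sym (Σ.*-distribˡ-sum k f) ⟩
  k * Σ.sum f             ≡⟨ cong (k *_) (sym (sumFin≡sum f)) ⟩
  k * sumFin f            ∎
  where open ≡-Reasoning

sumFin-comm : ∀ {k} (h : Fin m → Fin k → ℕ) →
  sumFin (λ i → sumFin (h i)) ≡ sumFin (λ j → sumFin (λ i → h i j))
sumFin-comm h = begin
  sumFin (λ i → sumFin (h i))
    ≡⟨ sumFin-cong (λ i → sumFin≡sum (h i)) ⟩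
  sumFin (λ i → Σ.sum (h i))
    ≡⟨ sumFin-via-sum {f = λ i → Σ.sum (h i)} {λ j → Σ.sum (λ i → h i j)} (Σ.∑-comm h) ⟩
  sumFin (λ j → Σ.sum (λ i → h i j))
    ≡⟨ sumFin-cong (λ j → sym (sumFin≡sum (λ i → h i j))) ⟩
  sumFin (λ j → sumFin (λ i → h i j)) ∎
  where open ≡-Reasoning

sumFin-mono-≤ : {f g : Fin m → ℕ} → (∀ i → f i ≤ g i) → sumFin f ≤ sumFin g
sumFin-mono-≤ {zero}  f≤g = z≤n
sumFin-mono-≤ {suc m} f≤g = +-mono-≤ (f≤g zero) (sumFin-mono-≤ (f≤g ∘ suc))

≤-sumFin : (f : Fin m → ℕ) (i : Fin m) → f i ≤ sumFin f
≤-sumFin f zero    = m≤m+n (f zero) _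
≤-sumFin f (suc i) = ≤-trans (≤-sumFin (f ∘ suc) i) (m≤n+m _ (f zero))

sumFin-zero : (f : Fin m → ℕ) → (∀ i → f i ≡ 0) → sumFin f ≡ 0
sumFin-zero {m} f f≗0 =
  trans (sumFin-cong f≗0) (trans (sumFin≡sum {m} (const 0)) (Σ.sum-replicate-zero m))

δ : Fin m → Fin m → ℕ
δ c i = b2n (does (i ≟ c))

δ-refl : (c : Fin m) → δ c c ≡ 1
δ-refl c = cong b2n (dec-true (c ≟ c) refl)

δ-≢ : {c i : Fin m} → i ≢ c → δ c i ≡ 0
δ-≢ {c = c} {i} i≢c = cong b2n (dec-false (i ≟ c) i≢c)

δ≤1 : (c i : Fin m) → δ c i ≤ 1
δ≤1 c i with i ≟ c
... | yes _ = ≤-refl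
... | no  _ = z≤n

sumFin-δ : (c : Fin m) → sumFin (δ c) ≡ 1
sumFin-δ {suc m} c = begin
  sumFin (δ c)                     ≡⟨ sumFin≡sum (δ c) ⟩
  Σ.sum (δ c)                      ≡⟨ Σ.sum-remove {i = c} (δ c) ⟩
  δ c c + Σ.sum (δ c ∘ punchIn c)  ≡⟨ cong₂ _+_ (δ-refl c) (sym (sumFin≡sum (δ c ∘ punchIn c))) ⟩
  1 + sumFin (δ c ∘ punchIn c)     ≡⟨ cong (1 +_) (sumFin-zero _ (λ j → δ-≢ (punchInᵢ≢i c j))) ⟩
  1                                ∎
  where open ≡-Reasoning

_without_ : (Fin m → Bool) → Fin m → Fin m → Bool
(p without x) i = p i ∧ not (does (i ≟ x))

count-without : (p : Fin m → Bool) {x : Fin m} → p x ≡ true → count p ≡ suc (count (p without x))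
count-without p {x} px = begin
  count p                                       ≡⟨ sumFin-cong split ⟩
  sumFin (λ i → δ x i + b2n ((p without x) i))  ≡⟨ sumFin-distrib-+ (δ x) (b2n ∘ (p without x)) ⟩
  sumFin (δ x) + count (p without x)            ≡⟨ cong (_+ count (p without x)) (sumFin-δ x) ⟩
  suc (count (p without x))                     ∎
  where
  open ≡-Reasoning
  split : ∀ i → b2n (p i) ≡ δ x i + b2n ((p without x) i)
  split i with i ≟ x
  ... | yes refl rewrite px = refl
  ... | no  _    rewrite ∧-identityʳ (p i) = refl

length≤count : (p : Fin m → Bool) {xs : List (Fin m)} →
  Unique xs → All (λ i → p i ≡ true) xs → length xs ≤ count p
length≤count p                 []                 []         = z≤n
length≤count p {xs = x ∷ _} (x∉xs ∷ unique-xs) (px ∷ pxs) rewrite count-without p px =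
  s≤s (length≤count (p without x) unique-xs (All.zipWith still-true (pxs , x∉xs)))
  where
  still-true : ∀ {y} → p y ≡ true × x ≢ y → (p without x) y ≡ true
  still-true {y} (py , x≢y) rewrite py | dec-false (y ≟ x) (x≢y ∘ sym) = refl

count>0⇒∃ : (p : Fin m → Bool) → 0 < count p → ∃ λ i → p i ≡ true
count>0⇒∃ {suc m} p pos with p zero in p0
... | true  = zero , p0
... | false with count>0⇒∃ (p ∘ suc) pos
...   | i , psi = suc i , psi

count≡0⇒false : (p : Fin m → Bool) → count p ≡ 0 → ∀ i → p i ≡ false
count≡0⇒false p count≡0 i with p i in pi
... | false = refl
... | true  = contradiction (subst (1 ≤_) count≡0 (length≤count p ([] ∷ []) (pi ∷ []))) λ ()

sumFin²-symmetrise : (h : Fin m → Fin m → ℕ) →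
  sumFin (λ u → sumFin (λ v → h u v + h v u)) ≡ 2 * sumFin (λ u → sumFin (h u))
sumFin²-symmetrise h = begin
  sumFin (λ u → sumFin (λ v → h u v + h v u))
    ≡⟨ sumFin-cong (λ u → sumFin-distrib-+ (h u) (λ v → h v u)) ⟩
  sumFin (λ u → sumFin (h u) + sumFin (λ v → h v u))
    ≡⟨ sumFin-distrib-+ (λ u → sumFin (h u)) (λ u → sumFin (λ v → h v u)) ⟩
  S + sumFin (λ u → sumFin (λ v → h v u))
    ≡⟨ cong (S +_) (sym (sumFin-comm h)) ⟩
  S + S
    ≡⟨ cong (S +_) (sym (+-identityʳ S)) ⟩
  2 * S ∎
  where
  open ≡-Reasoning
  S : ℕ
  S = sumFin (λ u → sumFin (h u))

sumFin²-cong-symmetrised : (h k : Fin m → Fin m → ℕ) → (∀ u v → h u v + h v u ≡ k u v + k v u) →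
  sumFin (λ u → sumFin (h u)) ≡ sumFin (λ u → sumFin (k u))
sumFin²-cong-symmetrised h k h≈k = *-cancelˡ-≡ _ _ 2 (begin
  2 * sumFin (λ u → sumFin (h u))              ≡⟨ sym (sumFin²-symmetrise h) ⟩
  sumFin (λ u → sumFin (λ v → h u v + h v u))  ≡⟨ sumFin-cong (λ u → sumFin-cong (h≈k u)) ⟩
  sumFin (λ u → sumFin (λ v → k u v + k v u))  ≡⟨ sumFin²-symmetrise k ⟩
  2 * sumFin (λ u → sumFin (k u))              ∎)
  where open ≡-Reasoning

isPair : Fin m → Fin m → Fin m → Fin m → Bool
isPair a b u v = (does (u ≟ a) ∧ does (v ≟ b)) ∨ (does (u ≟ b) ∧ does (v ≟ a))

isPair-sym : (a b u v : Fin m) → isPair a b u v ≡ isPair a b v u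
isPair-sym a b u v = begin
  (does (u ≟ a) ∧ does (v ≟ b)) ∨ (does (u ≟ b) ∧ does (v ≟ a))
    ≡⟨ cong₂ _∨_ (∧-comm (does (u ≟ a)) _) (∧-comm (does (u ≟ b)) _) ⟩
  (does (v ≟ b) ∧ does (u ≟ a)) ∨ (does (v ≟ a) ∧ does (u ≟ b))
    ≡⟨ ∨-comm (does (v ≟ b) ∧ _) _ ⟩
  (does (v ≟ a) ∧ does (u ≟ b)) ∨ (does (v ≟ b) ∧ does (u ≟ a)) ∎
  where open ≡-Reasoning

isPair⇒ : (a b u v : Fin m) → isPair a b u v ≡ true → (u ≡ a × v ≡ b) ⊎ (u ≡ b × v ≡ a)
isPair⇒ a b u v uv with u ≟ a | v ≟ b | u ≟ b | v ≟ a
... | yes u≡a | yes v≡b | _       | _       = inj₁ (u≡a , v≡b)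
... | _       | _       | yes u≡b | yes v≡a = inj₂ (u≡b , v≡a)
... | yes _   | no  _   | yes _   | no  _   = contradiction uv λ ()
... | yes _   | no  _   | no  _   | _       = contradiction uv λ ()
... | no  _   | _       | yes _   | no  _   = contradiction uv λ ()
... | no  _   | _       | no  _   | _       = contradiction uv λ ()

b2n-∧ : ∀ x y → b2n (x ∧ y) ≡ b2n x * b2n y
b2n-∧ false y     = refl
b2n-∧ true  false = refl
b2n-∧ true  true  = refl

b2n-∨ : ∀ {x y} → (x ≡ true → y ≡ true → ⊥) → b2n (x ∨ y) ≡ b2n x + b2n y
b2n-∨ {false} {y}     _        = refl
b2n-∨ {true}  {false} _        = refl
b2n-∨ {true}  {true}  disjoint = ⊥-elim (disjoint refl refl)

count-isPair : {a b : Fin m} → a ≢ b → ∀ v → count (isPair a b v) ≡ δ a v + δ b v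
count-isPair {a = a} {b} a≢b v = begin
  count (isPair a b v)
    ≡⟨ sumFin-cong split ⟩
  sumFin (λ j → δ a v * δ b j + δ b v * δ a j)
    ≡⟨ sumFin-distrib-+ (λ j → δ a v * δ b j) _ ⟩
  sumFin (λ j → δ a v * δ b j) + sumFin (λ j → δ b v * δ a j)
    ≡⟨ cong₂ _+_ (sumFin-*ˡ (δ a v) (δ b)) (sumFin-*ˡ (δ b v) (δ a)) ⟩
  δ a v * sumFin (δ b) + δ b v * sumFin (δ a)
    ≡⟨ cong₂ (λ s t → δ a v * s + δ b v * t) (sumFin-δ b) (sumFin-δ a) ⟩
  δ a v * 1 + δ b v * 1
    ≡⟨ cong₂ _+_ (*-identityʳ (δ a v)) (*-identityʳ (δ b v)) ⟩
  δ a v + δ b v ∎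
  where
  open ≡-Reasoning
  disjoint : ∀ j → does (v ≟ a) ∧ does (j ≟ b) ≡ true → does (v ≟ b) ∧ does (j ≟ a) ≡ true → ⊥
  disjoint j p q with v ≟ a | v ≟ b
  ... | yes refl | yes refl = a≢b refl
  ... | no  _    | _        = contradiction p λ ()
  ... | yes _    | no  _    = contradiction q λ ()
  split : ∀ j → b2n (isPair a b v j) ≡ δ a v * δ b j + δ b v * δ a j
  split j = trans (b2n-∨ (disjoint j)) (cong₂ _+_ (b2n-∧ (does (v ≟ a)) _) (b2n-∧ (does (v ≟ b)) _))

module _ {G : Graph} where

  private
    V : Set
    V = Fin (n G)

  adj⇒≢ : {u v : V} → adj G u v ≡ true → u ≢ v
  adj⇒≢ {u} uv refl = contradiction (trans (sym (irrefl G u)) uv) λ ()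

  mem⇒≢ : (R : EdgeSet G) {u v : V} → mem R u v ≡ true → u ≢ v
  mem⇒≢ R {u} {v} uv = adj⇒≢ (memSub R u v uv)

  walk-first-step : {x z : V} → Walk G x z → x ≢ z → ∃ λ y → adj G x y ≡ true
  walk-first-step here        x≢x = contradiction refl x≢x
  walk-first-step (step xy _) _   = _ , xy

  mem-irrefl : (R : EdgeSet G) (v : V) → mem R v v ≡ false
  mem-irrefl R v with mem R v v in vv
  ... | false = refl
  ... | true  = contradiction refl (mem⇒≢ R vv)

  handshake : (R : EdgeSet G) → sumFin (degIn R) ≡ 2 * size R
  handshake R = trans (sumFin-cong (λ u → sumFin-cong (split u))) (sumFin²-symmetrise forward)
    where
    forward : V → V → ℕ
    forward u v = b2n ((toℕ u <ᵇ toℕ v) ∧ mem R u v)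
    split : ∀ u v → b2n (mem R u v) ≡ forward u v + forward v u
    split u v with <-cmp (toℕ u) (toℕ v)
    ... | tri< u<v _ v≮u
      rewrite dec-true (toℕ u <? toℕ v) u<v | dec-false (toℕ v <? toℕ u) v≮u = sym (+-identityʳ _)
    ... | tri> u≮v _ v<u
      rewrite dec-false (toℕ u <? toℕ v) u≮v | dec-true (toℕ v <? toℕ u) v<u | memSym R u v = refl
    ... | tri≈ _ u≡v _ with toℕ-injective u≡v
    ...   | refl rewrite mem-irrefl R u | ∧-zeroʳ (toℕ u <ᵇ toℕ u) = refl

  insertEdge : (R : EdgeSet G) {a b : V} → adj G a b ≡ true → EdgeSet G
  insertEdge R {a} {b} ab = record
    { mem    = λ u v → isPair a b u v ∨ mem R u v
    ; memSym = λ u v → cong₂ _∨_ (isPair-sym a b u v) (memSym R u v)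
    ; memSub = inserted⊆adj
    }
    where
    inserted⊆adj : ∀ u v → isPair a b u v ∨ mem R u v ≡ true → adj G u v ≡ true
    inserted⊆adj u v uv with isPair a b u v in pair
    ... | false = memSub R u v uv
    ... | true with isPair⇒ a b u v pair
    ...   | inj₁ (refl , refl) = ab
    ...   | inj₂ (refl , refl) = trans (adj-sym G u v) ab

  deleteEdge : EdgeSet G → V → V → EdgeSet G
  deleteEdge R a b = record
    { mem    = λ u v → not (isPair a b u v) ∧ mem R u v
    ; memSym = λ u v → cong₂ (λ p q → not p ∧ q) (isPair-sym a b u v) (memSym R u v)
    ; memSub = remaining⊆adj
    }
    where
    remaining⊆adj : ∀ u v → not (isPair a b u v) ∧ mem R u v ≡ true → adj G u v ≡ true
    remaining⊆adj u v uv with isPair a b u v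
    ... | false = memSub R u v uv
    ... | true  = contradiction uv λ ()

  degIn-insertEdge : (R : EdgeSet G) {a b : V} (ab : adj G a b ≡ true) → mem R a b ≡ false →
    ∀ v → degIn (insertEdge R ab) v ≡ (δ a v + δ b v) + degIn R v
  degIn-insertEdge R {a} {b} ab ab∉R v = begin
    count (λ j → isPair a b v j ∨ mem R v j)
      ≡⟨ sumFin-cong (λ j → b2n-∨ (not-both j)) ⟩
    sumFin (λ j → b2n (isPair a b v j) + b2n (mem R v j))
      ≡⟨ sumFin-distrib-+ (b2n ∘ isPair a b v) _ ⟩
    count (isPair a b v) + degIn R v
      ≡⟨ cong (_+ degIn R v) (count-isPair (adj⇒≢ ab) v) ⟩
    (δ a v + δ b v) + degIn R v ∎
    where
    open ≡-Reasoning
    not-both : ∀ j → isPair a b v j ≡ true → mem R v j ≡ true → ⊥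
    not-both j pair vj with isPair⇒ a b v j pair
    ... | inj₁ (refl , refl) = contradiction (trans (sym vj) ab∉R) λ ()
    ... | inj₂ (refl , refl) = contradiction (trans (sym vj) (trans (memSym R v j) ab∉R)) λ ()

  degIn-deleteEdge : (R : EdgeSet G) {a b : V} → mem R a b ≡ true →
    ∀ v → degIn R v ≡ (δ a v + δ b v) + degIn (deleteEdge R a b) v
  degIn-deleteEdge R {a} {b} ab∈R v = begin
    degIn R v
      ≡⟨ sumFin-cong split ⟩
    sumFin (λ j → b2n (isPair a b v j) + b2n (mem (deleteEdge R a b) v j))
      ≡⟨ sumFin-distrib-+ (b2n ∘ isPair a b v) _ ⟩
    count (isPair a b v) + degIn (deleteEdge R a b) v
      ≡⟨ cong (_+ degIn (deleteEdge R a b) v) (count-isPair (mem⇒≢ R ab∈R) v) ⟩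
    (δ a v + δ b v) + degIn (deleteEdge R a b) v ∎
    where
    open ≡-Reasoning
    pair∈R : ∀ j → isPair a b v j ≡ true → mem R v j ≡ true
    pair∈R j pair with isPair⇒ a b v j pair
    ... | inj₁ (refl , refl) = ab∈R
    ... | inj₂ (refl , refl) = trans (memSym R _ _) ab∈R
    split : ∀ j → b2n (mem R v j) ≡ b2n (isPair a b v j) + b2n (not (isPair a b v j) ∧ mem R v j)
    split j with isPair a b v j in pair
    ... | true  rewrite pair∈R j pair = refl
    ... | false = refl

  -- An R-edge whose ends both have R-degree 1 is charged entirely to its end of smaller index, so
  -- that this end gets weight 2 while the total weight stays 2|R|.
  charge : EdgeSet G → V → V → ℕ
  charge R v u =
    if mem R v u
    then (if (degIn R v ≡ᵇ 1) ∧ (degIn R u ≡ᵇ 1) then (if toℕ v <ᵇ toℕ u then 2 else 0) else 1)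
    else 0

  weight : EdgeSet G → V → ℕ
  weight R v = sumFin (charge R v)

  charge-symmetrised : (R : EdgeSet G) (v u : V) →
    charge R v u + charge R u v ≡ b2n (mem R v u) + b2n (mem R u v)
  charge-symmetrised R v u
    rewrite memSym R u v | ∧-comm (degIn R u ≡ᵇ 1) (degIn R v ≡ᵇ 1)
    with mem R v u in vu | (degIn R v ≡ᵇ 1) ∧ (degIn R u ≡ᵇ 1)
  ... | false | _     = refl
  ... | true  | false = refl
  ... | true  | true with <-cmp (toℕ v) (toℕ u)
  ...   | tri< v<u _ u≮v
    rewrite dec-true (toℕ v <? toℕ u) v<u | dec-false (toℕ u <? toℕ v) u≮v = refl
  ...   | tri> v≮u _ u<v
    rewrite dec-false (toℕ v <? toℕ u) v≮u | dec-true (toℕ u <? toℕ v) u<v = refl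
  ...   | tri≈ _ v≡u _ = contradiction (toℕ-injective v≡u) (mem⇒≢ R vu)

  weight-sum : (R : EdgeSet G) → sumFin (weight R) ≡ 2 * size R
  weight-sum R = begin
    sumFin (weight R)
      ≡⟨ sumFin²-cong-symmetrised (charge R) (λ v u → b2n (mem R v u)) (charge-symmetrised R) ⟩
    sumFin (degIn R)
      ≡⟨ handshake R ⟩
    2 * size R ∎
    where open ≡-Reasoning

  weight≡degIn : (R : EdgeSet G) {v : V} → degIn R v ≢ 1 → weight R v ≡ degIn R v
  weight≡degIn R {v} dv≢1 = sumFin-cong charge≡edge
    where
    charge≡edge : ∀ u → charge R v u ≡ b2n (mem R v u)
    charge≡edge u with mem R v u
    ... | false = refl
    ... | true rewrite dec-false (degIn R v ≟ℕ 1) dv≢1 = refl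

  2≤weight-at-smaller-end : (R : EdgeSet G) {v u : V} → mem R v u ≡ true →
    degIn R v ≡ 1 → degIn R u ≡ 1 → toℕ v < toℕ u → 2 ≤ weight R v
  2≤weight-at-smaller-end R {v} {u} vu dv≡1 du≡1 v<u =
    subst (_≤ weight R v) charge≡2 (≤-sumFin (charge R v) u)
    where
    charge≡2 : charge R v u ≡ 2
    charge≡2 rewrite vu | dv≡1 | du≡1 | dec-true (toℕ v <? toℕ u) v<u = refl

module MaximumPacking {G : Graph} (R : EdgeSet G) (R-max : IsMax2Packing R) where

  private
    V : Set
    V = Fin (n G)

    d : V → ℕ
    d = degIn R

    R-packing : Is2Packing R
    R-packing = proj₁ R-max

  no-augmentation : (R' : EdgeSet G) {x y : V} → (∀ v → degIn R' v ≡ (δ x v + δ y v) + d v) →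
    degIn R' x ≤ 2 → degIn R' y ≤ 2 → ⊥
  no-augmentation R' {x} {y} degrees x-fits y-fits =
    1+n≰n (subst (_≤ size R) (*-cancelˡ-≡ _ _ 2 size-grows) (proj₂ R-max R' R'-packing))
    where
    R'-packing : Is2Packing R'
    R'-packing v with v ≟ x | v ≟ y
    ... | yes refl | _        = x-fits
    ... | no  _    | yes refl = y-fits
    ... | no  v≢x  | no  v≢y  rewrite degrees v | δ-≢ v≢x | δ-≢ v≢y = R-packing v
    size-grows : 2 * size R' ≡ 2 * suc (size R)
    size-grows = begin
      2 * size R'
        ≡⟨ sym (handshake R') ⟩
      sumFin (degIn R')
        ≡⟨ sumFin-cong degrees ⟩
      sumFin (λ v → (δ x v + δ y v) + d v)
        ≡⟨ sumFin-distrib-+ (λ v → δ x v + δ y v) d ⟩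
      sumFin (λ v → δ x v + δ y v) + sumFin d
        ≡⟨ cong (_+ sumFin d) (sumFin-distrib-+ (δ x) (δ y)) ⟩
      (sumFin (δ x) + sumFin (δ y)) + sumFin d
        ≡⟨ cong₂ (λ s t → (s + t) + sumFin d) (sumFin-δ x) (sumFin-δ y) ⟩
      2 + sumFin d
        ≡⟨ cong (2 +_) (handshake R) ⟩
      2 + 2 * size R
        ≡⟨ sym (*-suc 2 (size R)) ⟩
      2 * suc (size R) ∎
      where open ≡-Reasoning

  no-insertable-edge : {x y : V} → adj G x y ≡ true → mem R x y ≡ false → d x ≤ 1 → d y ≤ 1 → ⊥
  no-insertable-edge {x} {y} xy xy∉R dx≤1 dy≤1 = no-augmentation R' degrees x-fits y-fits
    where
    open ≤-Reasoning
    R' : EdgeSet G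
    R' = insertEdge R xy
    degrees : ∀ v → degIn R' v ≡ (δ x v + δ y v) + d v
    degrees = degIn-insertEdge R xy xy∉R
    x-fits : degIn R' x ≤ 2
    x-fits = begin
      degIn R' x
        ≡⟨ degrees x ⟩
      (δ x x + δ y x) + d x
        ≡⟨ cong₂ (λ p q → (p + q) + d x) (δ-refl x) (δ-≢ (adj⇒≢ {G = G} xy)) ⟩
      suc (d x)
        ≤⟨ s≤s dx≤1 ⟩
      2 ∎
    y-fits : degIn R' y ≤ 2
    y-fits = begin
      degIn R' y
        ≡⟨ degrees y ⟩
      (δ x y + δ y y) + d y
        ≡⟨ cong₂ (λ p q → (p + q) + d y) (δ-≢ (adj⇒≢ {G = G} xy ∘ sym)) (δ-refl y) ⟩
      suc (d y)
        ≤⟨ s≤s dy≤1 ⟩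
      2 ∎

  no-exchange : {a b x y : V} → mem R a b ≡ true →
    adj G a x ≡ true → d x ≡ 0 → adj G b y ≡ true → d y ≡ 0 → ⊥
  no-exchange {a} {b} {x} {y} ab∈R ax dx≡0 by dy≡0 =
    no-augmentation R₃ degrees (fits x dx≡0) (fits y dy≡0)
    where
    uncovered-edge : ∀ {z} → d z ≡ 0 → ∀ w → mem R z w ≡ false
    uncovered-edge {z} dz≡0 = count≡0⇒false (mem R z) dz≡0
    y≢a : y ≢ a
    y≢a refl = contradiction (trans (sym (uncovered-edge dy≡0 b)) ab∈R) λ ()
    xa : adj G x a ≡ true
    xa = trans (adj-sym G x a) ax
    yb : adj G y b ≡ true
    yb = trans (adj-sym G y b) by
    R₁ : EdgeSet G
    R₁ = deleteEdge R a b
    xa∉R₁ : mem R₁ x a ≡ false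
    xa∉R₁ rewrite uncovered-edge dx≡0 a = ∧-zeroʳ _
    R₂ : EdgeSet G
    R₂ = insertEdge R₁ xa
    yb∉R₂ : mem R₂ y b ≡ false
    yb∉R₂ rewrite dec-false (b ≟ a) (mem⇒≢ R ab∈R ∘ sym) | dec-false (y ≟ a) y≢a
                | uncovered-edge dy≡0 b =
      cong₂ _∨_ (cong (_∨ false) (∧-zeroʳ (does (y ≟ x)))) (∧-zeroʳ (not (does (y ≟ b) ∧ false)))
    R₃ : EdgeSet G
    R₃ = insertEdge R₂ yb
    degrees : ∀ v → degIn R₃ v ≡ (δ x v + δ y v) + d v
    degrees v = begin
      degIn R₃ v
        ≡⟨ degIn-insertEdge R₂ yb yb∉R₂ v ⟩
      (δ y v + δ b v) + degIn R₂ v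
        ≡⟨ cong ((δ y v + δ b v) +_) (degIn-insertEdge R₁ xa xa∉R₁ v) ⟩
      (δ y v + δ b v) + ((δ x v + δ a v) + degIn R₁ v)
        ≡⟨ regroup (δ x v) (δ y v) (δ a v) (δ b v) (degIn R₁ v) ⟩
      (δ x v + δ y v) + ((δ a v + δ b v) + degIn R₁ v)
        ≡⟨ cong ((δ x v + δ y v) +_) (sym (degIn-deleteEdge R ab∈R v)) ⟩
      (δ x v + δ y v) + d v ∎
      where
      open ≡-Reasoning
      regroup : ∀ x y a b r → (y + b) + ((x + a) + r) ≡ (x + y) + ((a + b) + r)
      regroup = solve-∀
    fits : ∀ z → d z ≡ 0 → degIn R₃ z ≤ 2
    fits z dz≡0 = begin
      degIn R₃ z             ≡⟨ degrees z ⟩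
      (δ x z + δ y z) + d z  ≡⟨ cong ((δ x z + δ y z) +_) dz≡0 ⟩
      (δ x z + δ y z) + 0    ≡⟨ +-identityʳ _ ⟩
      δ x z + δ y z          ≤⟨ +-mono-≤ (δ≤1 x z) (δ≤1 y z) ⟩
      2                      ∎
      where open ≤-Reasoning

  degree-cases : (v : V) → d v ≡ 0 ⊎ d v ≡ 1 ⊎ d v ≡ 2
  degree-cases v with d v | R-packing v
  ... | 0                 | _ = inj₁ refl
  ... | 1                 | _ = inj₂ (inj₁ refl)
  ... | 2                 | _ = inj₂ (inj₂ refl)
  ... | suc (suc (suc _)) | s≤s (s≤s ())

  NextToUncovered : V → Set
  NextToUncovered a = ∃ λ z → adj G a z ≡ true × d z ≡ 0

  next-to-uncovered? : ∀ a → Dec (NextToUncovered a)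
  next-to-uncovered? a = any? (λ z → (adj G a z ≟ᴮ true) ×-dec (d z ≟ℕ 0))

  Clean : V → Set
  Clean a = ¬ NextToUncovered a

  some-end-clean : {a b : V} → mem R a b ≡ true → Clean a ⊎ Clean b
  some-end-clean {a} {b} ab∈R with next-to-uncovered? a | next-to-uncovered? b
  ... | yes (x , ax , dx≡0) | yes (y , by , dy≡0) = ⊥-elim (no-exchange ab∈R ax dx≡0 by dy≡0)
  ... | no  a-clean         | _                   = inj₁ a-clean
  ... | yes _               | no  b-clean         = inj₂ b-clean

  record TwoNeighbours (z : V) (L : List V) : Set where
    field
      left right : V
      left≢right : left ≢ right
      left-edge  : mem R z left ≡ true
      right-edge : mem R z right ≡ true
      left∈      : left ∈ L
      right∈     : right ∈ L

  TwoNeighbours-⊆ : ∀ {z L L'} → (∀ {w} → w ∈ L → w ∈ L') → TwoNeighbours z L → TwoNeighbours z L'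
  TwoNeighbours-⊆ L⊆L' N = record
    { left = left ; right = right ; left≢right = left≢right
    ; left-edge = left-edge ; right-edge = right-edge
    ; left∈ = L⊆L' left∈ ; right∈ = L⊆L' right∈ }
    where open TwoNeighbours N

  other-neighbour : ∀ {z L} → TwoNeighbours z L → (o : V) →
    ∃ λ w → mem R z w ≡ true × w ≢ o × w ∈ L
  other-neighbour {z} {L} N o = choose (left ≟ o)
    where
    open TwoNeighbours N
    choose : Dec (left ≡ o) → ∃ λ w → mem R z w ≡ true × w ≢ o × w ∈ L
    choose (yes refl)   = right , right-edge , left≢right ∘ sym , right∈
    choose (no  left≢o) = left , left-edge , left≢o , left∈

  interior-neighbours : ∀ p xs t → PathIn R (p ∷ xs ++ t ∷ []) → Unique (p ∷ xs ++ t ∷ []) →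
    ∀ {z} → z ∈ xs → TwoNeighbours z (p ∷ xs ++ t ∷ [])
  interior-neighbours p (x ∷ []) t (px , xt , _) (p∉ ∷ _) (here refl) = record
    { left = p ; right = t ; left≢right = All.lookup p∉ (there (here refl))
    ; left-edge = trans (memSym R x p) px ; right-edge = xt
    ; left∈ = here refl ; right∈ = there (there (here refl)) }
  interior-neighbours p (x ∷ y ∷ ys) t (px , xy , _) (p∉ ∷ _) (here refl) = record
    { left = p ; right = y ; left≢right = All.lookup p∉ (there (here refl))
    ; left-edge = trans (memSym R x p) px ; right-edge = xy
    ; left∈ = here refl ; right∈ = there (there (here refl)) }
  interior-neighbours p (x ∷ xs) t (_ , path) (_ ∷ unique) (there z∈xs) =
    TwoNeighbours-⊆ there (interior-neighbours x xs t path unique z∈xs)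

  predecessor-of-last : ∀ p xs t → PathIn R (p ∷ xs ++ t ∷ []) →
    ∃ λ q → mem R t q ≡ true × q ∈ p ∷ xs
  predecessor-of-last p []       t (pt , _)   = p , trans (memSym R t p) pt , here refl
  predecessor-of-last p (x ∷ xs) t (_ , path) with predecessor-of-last x xs t path
  ... | q , tq , q∈ = q , tq , there q∈

  vertices : CycleIn R → List V
  vertices C = first ∷ rest ++ last ∷ []
    where open CycleIn C

  cycle-neighbours : (C : CycleIn R) {z : V} → z ∈ vertices C → TwoNeighbours z (vertices C)
  cycle-neighbours record { rest = [] ; long = () }
  cycle-neighbours record { first = f ; rest = r ∷ rs ; last = l ; distinct = f∉ ∷ r∉ ∷ _
                          ; path = fr , _ ; closing = lf } (here refl) = record
    { left = r ; right = l ; left≢right = All.lookup r∉ (∈-++⁺ʳ rs (here refl))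
    ; left-edge = fr ; right-edge = trans (memSym R f l) lf
    ; left∈ = there (here refl) ; right∈ = there (∈-++⁺ʳ (r ∷ rs) (here refl)) }
  cycle-neighbours record { first = f ; rest = r ∷ rs ; last = l ; distinct = unique
                          ; path = path ; closing = lf } (there z∈) with ∈-++⁻ (r ∷ rs) z∈
  ... | inj₁ z∈rest     = interior-neighbours f (r ∷ rs) l path unique z∈rest
  ... | inj₂ (there ())
  ... | inj₂ (here refl) with predecessor-of-last r rs l (proj₂ path) | unique
  ...   | q , lq , q∈ | f∉ ∷ _ = record
    { left = f ; right = q ; left≢right = All.lookup f∉ (∈-++⁺ˡ q∈)
    ; left-edge = lf ; right-edge = lq
    ; left∈ = here refl ; right∈ = there (∈-++⁺ˡ q∈) }

  cycle-degree : (C : CycleIn R) {z : V} → z ∈ vertices C → d z ≡ 2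
  cycle-degree C {z} z∈ = ≤-antisym (R-packing z)
    (length≤count (mem R z) ((left≢right ∷ []) ∷ [] ∷ []) (left-edge ∷ right-edge ∷ []))
    where open TwoNeighbours (cycle-neighbours C z∈)

  cycle-closed : (C : CycleIn R) {z y : V} → z ∈ vertices C → mem R z y ≡ true → y ∈ vertices C
  cycle-closed C {z} {y} z∈ zy = choose (y ≟ left) (y ≟ right)
    where
    open TwoNeighbours (cycle-neighbours C z∈)
    choose : Dec (y ≡ left) → Dec (y ≡ right) → y ∈ vertices C
    choose (yes refl) _          = left∈
    choose (no  _)    (yes refl) = right∈
    choose (no  y≢l)  (no  y≢r)  = contradiction (≤-trans 3≤d (R-packing z)) λ { (s≤s (s≤s ())) }
      where
      3≤d : 3 ≤ d z
      3≤d = length≤count (mem R z)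
        ((left≢right ∷ y≢l ∘ sym ∷ []) ∷ (y≢r ∘ sym ∷ []) ∷ [] ∷ [])
        (left-edge ∷ right-edge ∷ zy ∷ [])

  leaf-off-cycle : (C : CycleIn R) {v c : V} → d v ≡ 1 → c ∈ vertices C → v ≢ c
  leaf-off-cycle C dv≡1 c∈ refl = contradiction (trans (sym dv≡1) (cycle-degree C c∈)) λ ()

  leaf-neighbour-off-cycle : (C : CycleIn R) {u x c : V} →
    mem R u x ≡ true → d x ≡ 1 → c ∈ vertices C → u ≢ c
  leaf-neighbour-off-cycle C ux dx≡1 c∈ refl = leaf-off-cycle C dx≡1 (cycle-closed C c∈ ux) refl

  record CleanPair (L : List V) : Set where
    field
      c₁ c₂    : V
      c₁≢c₂    : c₁ ≢ c₂
      c₁∈      : c₁ ∈ L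
      c₂∈      : c₂ ∈ L
      c₁-clean : Clean c₁
      c₂-clean : Clean c₂

  clean-pair-on-path : {L : List V} {f r t u : V} → f ∈ L → r ∈ L → t ∈ L → u ∈ L →
    f ≢ t → r ≢ u → mem R f r ≡ true → mem R r t ≡ true → mem R t u ≡ true → CleanPair L
  clean-pair-on-path f∈ r∈ t∈ u∈ f≢t r≢u fr rt tu with some-end-clean fr
  ... | inj₁ f-clean with some-end-clean rt
  ...   | inj₁ r-clean = record
    { c₁≢c₂ = mem⇒≢ R fr ; c₁∈ = f∈ ; c₂∈ = r∈ ; c₁-clean = f-clean ; c₂-clean = r-clean }
  ...   | inj₂ t-clean = record
    { c₁≢c₂ = f≢t ; c₁∈ = f∈ ; c₂∈ = t∈ ; c₁-clean = f-clean ; c₂-clean = t-clean }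
  clean-pair-on-path f∈ r∈ t∈ u∈ f≢t r≢u fr rt tu | inj₂ r-clean with some-end-clean tu
  ...   | inj₁ t-clean = record
    { c₁≢c₂ = mem⇒≢ R rt ; c₁∈ = r∈ ; c₂∈ = t∈ ; c₁-clean = r-clean ; c₂-clean = t-clean }
  ...   | inj₂ u-clean = record
    { c₁≢c₂ = r≢u ; c₁∈ = r∈ ; c₂∈ = u∈ ; c₁-clean = r-clean ; c₂-clean = u-clean }

  -- right, first, left, w are consecutive vertices of the cycle.
  clean-pair-on-cycle : (C : CycleIn R) → CleanPair (vertices C)
  clean-pair-on-cycle C with cycle-neighbours C (here refl)
  ... | N with other-neighbour (cycle-neighbours C (TwoNeighbours.left∈ N)) (CycleIn.first C)
  ...   | w , left-w , w≢first , w∈ =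
    clean-pair-on-path right∈ (here refl) left∈ w∈ (left≢right ∘ sym) (w≢first ∘ sym)
      (trans (memSym R right (CycleIn.first C)) right-edge) left-edge left-w
    where open TwoNeighbours N

  module Domination (connected : Connected G) (C : CycleIn R) (P : CleanPair (vertices C)) where

    open CleanPair P

    D : VSet G
    D v = does (2 ≤? weight R v) ∧ not (does (v ≟ c₁)) ∧ not (does (v ≟ c₂))

    D-intro : {v : V} → 2 ≤ weight R v → v ≢ c₁ → v ≢ c₂ → D v ≡ true
    D-intro {v} 2≤w v≢c₁ v≢c₂
      rewrite dec-true (2 ≤? weight R v) 2≤w | dec-false (v ≟ c₁) v≢c₁ | dec-false (v ≟ c₂) v≢c₂
      = refl

    weight≡2 : {v : V} → d v ≡ 2 → weight R v ≡ 2
    weight≡2 dv≡2 =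
      trans (weight≡degIn R (λ dv≡1 → contradiction (trans (sym dv≡1) dv≡2) λ ())) dv≡2

    D-intro-degree-2 : {v : V} → d v ≡ 2 → v ≢ c₁ → v ≢ c₂ → D v ≡ true
    D-intro-degree-2 dv≡2 = D-intro (≤-reflexive (sym (weight≡2 dv≡2)))

    marker : V → ℕ
    marker v = (δ c₁ v + δ c₂ v) + b2n (D v)

    marker-sum : sumFin marker ≡ 2 + card {G} D
    marker-sum = begin
      sumFin marker
        ≡⟨ sumFin-distrib-+ (λ v → δ c₁ v + δ c₂ v) (b2n ∘ D) ⟩
      sumFin (λ v → δ c₁ v + δ c₂ v) + card {G} D
        ≡⟨ cong (_+ card {G} D) (sumFin-distrib-+ (δ c₁) (δ c₂)) ⟩
      (sumFin (δ c₁) + sumFin (δ c₂)) + card {G} D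
        ≡⟨ cong₂ (λ s t → (s + t) + card {G} D) (sumFin-δ c₁) (sumFin-δ c₂) ⟩
      2 + card {G} D ∎
      where open ≡-Reasoning

    -- The left-hand side is 2 * marker v with the decisions inside D v taken as arguments,
    -- so that they can be split on.
    2*marker≤weight : ∀ v (2≤w? : Dec (2 ≤ weight R v)) (v≟c₁ : Dec (v ≡ c₁)) (v≟c₂ : Dec (v ≡ c₂)) →
      2 * ((b2n (does v≟c₁) + b2n (does v≟c₂))
           + b2n (does 2≤w? ∧ not (does v≟c₁) ∧ not (does v≟c₂)))
        ≤ weight R v
    2*marker≤weight v _         (yes refl) (yes v≡c₂) = contradiction v≡c₂ c₁≢c₂
    2*marker≤weight v (yes _)   (yes refl) (no  _)    = ≤-reflexive (sym (weight≡2 (cycle-degree C c₁∈)))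
    2*marker≤weight v (no  _)   (yes refl) (no  _)    = ≤-reflexive (sym (weight≡2 (cycle-degree C c₁∈)))
    2*marker≤weight v (yes _)   (no  _)    (yes refl) = ≤-reflexive (sym (weight≡2 (cycle-degree C c₂∈)))
    2*marker≤weight v (no  _)   (no  _)    (yes refl) = ≤-reflexive (sym (weight≡2 (cycle-degree C c₂∈)))
    2*marker≤weight v (yes 2≤w) (no  _)    (no  _)    = 2≤w
    2*marker≤weight v (no  _)   (no  _)    (no  _)    = z≤n

    D-small : 2 + card {G} D ≤ size R
    D-small = *-cancelˡ-≤ 2 (begin
      2 * (2 + card {G} D)
        ≡⟨ cong (2 *_) (sym marker-sum) ⟩
      2 * sumFin marker
        ≡⟨ sym (sumFin-*ˡ 2 marker) ⟩
      sumFin (λ v → 2 * marker v)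
        ≤⟨ sumFin-mono-≤ (λ v → 2*marker≤weight v (2 ≤? weight R v) (v ≟ c₁) (v ≟ c₂)) ⟩
      sumFin (weight R)
        ≡⟨ weight-sum R ⟩
      2 * size R ∎)
      where open ≤-Reasoning

    Dominated : V → Set
    Dominated x = D x ≡ true ⊎ ∃ λ u → D u ≡ true × adj G u x ≡ true

    R-neighbour-dominates : {u x : V} → mem R u x ≡ true → D u ≡ true → Dominated x
    R-neighbour-dominates {u} {x} ux Du = inj₂ (u , Du , memSub R u x ux)

    dominated-on-pair : {z o : V} → z ∈ vertices C →
      (∀ {w} → w ≢ z → w ≢ o → w ≢ c₁ × w ≢ c₂) → Dominated z
    dominated-on-pair {z} {o} z∈ off-pair with other-neighbour (cycle-neighbours C z∈) o
    ... | w , zw , w≢o , w∈ =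
      R-neighbour-dominates wz (D-intro-degree-2 (cycle-degree C w∈) w≢c₁ w≢c₂)
      where
      wz : mem R w z ≡ true
      wz = trans (memSym R w z) zw
      w≢c₁ : w ≢ c₁
      w≢c₁ = proj₁ (off-pair (mem⇒≢ R wz) w≢o)
      w≢c₂ : w ≢ c₂
      w≢c₂ = proj₂ (off-pair (mem⇒≢ R wz) w≢o)

    dominated-of-degree-0 : {x : V} → d x ≡ 0 → x ≢ c₁ → Dominated x
    dominated-of-degree-0 {x} dx≡0 x≢c₁ with walk-first-step (connected x c₁) x≢c₁
    ... | y , xy with d y ≟ℕ 2
    ...   | yes dy≡2 = inj₂ (y , D-intro-degree-2 dy≡2 (y≢clean c₁-clean) (y≢clean c₂-clean) , yx)
      where
      yx : adj G y x ≡ true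
      yx = trans (adj-sym G y x) xy
      y≢clean : ∀ {c} → Clean c → y ≢ c
      y≢clean c-clean refl = c-clean (x , yx , dx≡0)
    ...   | no  dy≢2 = ⊥-elim (no-insertable-edge xy (count≡0⇒false (mem R x) dx≡0 y)
                         (≤-trans (≤-reflexive dx≡0) z≤n) (≤-pred (≤∧≢⇒< (R-packing y) dy≢2)))

    end-of-isolated-edge-dominated : {x u : V} → mem R x u ≡ true → d x ≡ 1 → d u ≡ 1 → Dominated x
    end-of-isolated-edge-dominated {x} {u} xu dx≡1 du≡1 with <-cmp (toℕ x) (toℕ u)
    ... | tri< x<u _ _ = inj₁ (D-intro (2≤weight-at-smaller-end R xu dx≡1 du≡1 x<u)
                                       (leaf-off-cycle C dx≡1 c₁∈) (leaf-off-cycle C dx≡1 c₂∈))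
    ... | tri≈ _ x≡u _ = contradiction (toℕ-injective x≡u) (mem⇒≢ R xu)
    ... | tri> _ _ u<x = R-neighbour-dominates ux (D-intro (2≤weight-at-smaller-end R ux du≡1 dx≡1 u<x)
                           (leaf-off-cycle C du≡1 c₁∈) (leaf-off-cycle C du≡1 c₂∈))
      where
      ux : mem R u x ≡ true
      ux = trans (memSym R u x) xu

    dominated-of-degree-1 : {x : V} → d x ≡ 1 → Dominated x
    dominated-of-degree-1 {x} dx≡1 with count>0⇒∃ (mem R x) (subst (0 <_) (sym dx≡1) (s≤s z≤n))
    ... | u , xu = by-degree (degree-cases u)
      where
      ux : mem R u x ≡ true
      ux = trans (memSym R u x) xu
      by-degree : d u ≡ 0 ⊎ d u ≡ 1 ⊎ d u ≡ 2 → Dominated x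
      by-degree (inj₁ du≡0) =
        contradiction (subst (1 ≤_) du≡0 (length≤count (mem R u) ([] ∷ []) (ux ∷ []))) λ ()
      by-degree (inj₂ (inj₁ du≡1)) = end-of-isolated-edge-dominated xu dx≡1 du≡1
      by-degree (inj₂ (inj₂ du≡2)) = R-neighbour-dominates ux (D-intro-degree-2 du≡2
        (leaf-neighbour-off-cycle C ux dx≡1 c₁∈) (leaf-neighbour-off-cycle C ux dx≡1 c₂∈))

    dominated-off-pair : {x : V} → x ≢ c₁ → x ≢ c₂ → Dominated x
    dominated-off-pair {x} x≢c₁ x≢c₂ with degree-cases x
    ... | inj₁ dx≡0        = dominated-of-degree-0 dx≡0 x≢c₁
    ... | inj₂ (inj₁ dx≡1) = dominated-of-degree-1 dx≡1
    ... | inj₂ (inj₂ dx≡2) = inj₁ (D-intro-degree-2 dx≡2 x≢c₁ x≢c₂)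

    D-dominates : Dominating G D
    D-dominates x = by-cases (x ≟ c₁) (x ≟ c₂)
      where
      by-cases : Dec (x ≡ c₁) → Dec (x ≡ c₂) → Dominated x
      by-cases (yes x≡c₁) _ =
        subst Dominated (sym x≡c₁) (dominated-on-pair c₁∈ (λ w≢c₁ w≢c₂ → w≢c₁ , w≢c₂))
      by-cases (no _) (yes x≡c₂) =
        subst Dominated (sym x≡c₂) (dominated-on-pair c₂∈ (λ w≢c₂ w≢c₁ → w≢c₁ , w≢c₂))
      by-cases (no x≢c₁) (no x≢c₂) = dominated-off-pair x≢c₁ x≢c₂

lemma3p5 : (G : Graph) → Connected G → (R : EdgeSet G) → IsMax2Packing R
    → size R < numEdges G → 5 ≤ size R
    → IsDominationNumber G (size R ∸ 1)
    → IsForest R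
lemma3p5 G connected R R-max _ _ (_ , γ-minimal) C =
  n≮n (card {G} D) (≤-trans (∸-monoˡ-≤ 1 D-small) (γ-minimal D D-dominates))
  where
  open MaximumPacking R R-max
  open Domination connected C (clean-pair-on-cycle C)
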